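{- Let $\Phi$ be a finite set of closed formulas of the $\epsilon$-arithmetic language, and let $S$ and $T$ be two substitutions providing substituents for all categories of the $\epsilon$-terms occurring in $\Phi$. If $T$ is progressive on $S$, then either (1) $o(T)<o(S)$, or (2) every closed $\epsilon$-term occurring in the formulas of $\Phi$ receives the same value under $S$ and under $T$.
   Context: Language of $\epsilon$-arithmetic: terms are built from variables, $0$, the unary function symbols $'$ (successor) and $d$ (predecessor), the binary symbols $+,\times$, and $\epsilon$-terms $\epsilon_x A$ where $A$ is a formula; formulas are built from equations $a=b$ with $\to$ and $\sim$ (negation). For a closed $\epsilon$-term $\epsilon_x A$, its category is the term obtained by replacing each of its immediate subterms in which $x$ does not occur free by a fresh variable; a category with $k$ free variables is a $k$-ary pattern. A substitution relative to $\Phi$ assigns to each category (with $k$ free variables) of the $\epsilon$-terms of $\Phi$ a function $\mathbb{N}^k\to\mathbb{N}$ (its substituent). Under a substitution, every closed term gets a numerical value computed recursively: $0,',d,+,\times$ have their usual meaning (with $d(0)=0$, $d(a')=a$), and a closed $\epsilon$-term gets the value of the substituent of its category applied to the values of the subterms that were replaced by variables. Order of a substitution: fix an enumeration $a_0,\dots,a_k$ of the closed $\epsilon$-terms occurring in $\Phi$ such that each subterm precedes any term containing it; set $o(S)=\sum_{i=0}^{k}2^{k-i}f(i)$, where $f(i)=1$ if $S$ gives $a_i$ the value $0$ and $f(i)=0$ otherwise. $T$ is progressive on $S$ if, whenever a substituent of $S$ takes a nonzero value at some argument tuple, the substituent of $T$ for the same category takes the same value at that argument tuple. -}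

module Defs where

open import Data.Nat using (ℕ; zero; suc; _+_; _*_; _^_; _≤_; _<_; _⊔_; pred)
open import Data.Nat.Properties using (_≟_)
open import Data.Bool using (Bool; true; false; if_then_else_)
open import Data.List using (List; []; _∷_; _++_; length; lookup; map; null; [_])
open import Data.List.Membership.Propositional using (_∈_)
open import Data.List.Relation.Unary.Unique.Propositional using (Unique)
open import Data.Fin using (Fin; toℕ)
open import Data.Product using (Σ; _×_; _,_; proj₁; proj₂; ∃-syntax)
open import Relation.Nullary using (¬_; yes; no)
open import Relation.Binary.PropositionalEquality using (_≡_)
open import Function.Bundles using (_⇔_)

mutual
  data Term : Set where
    var  : ℕ → Term
    zer  : Term
    sc   : Term → Term
    dd   : Term → Term
    pl   : Term → Term → Term
    tm   : Term → Term → Term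
    eps  : ℕ → Formula → Term

  data Formula : Set where
    eqn  : Term → Term → Formula
    imp  : Formula → Formula → Formula
    neg  : Formula → Formula

remove : ℕ → List ℕ → List ℕ
remove y [] = []
remove y (z ∷ zs) with z ≟ y
... | yes _ = remove y zs
... | no  _ = z ∷ remove y zs

mutual
  fvT : Term → List ℕ
  fvT (var y)   = [ y ]
  fvT zer       = []
  fvT (sc a)    = fvT a
  fvT (dd a)    = fvT a
  fvT (pl a b)  = fvT a ++ fvT b
  fvT (tm a b)  = fvT a ++ fvT b
  fvT (eps y A) = remove y (fvF A)

  fvF : Formula → List ℕ
  fvF (eqn a b) = fvT a ++ fvT b
  fvF (imp A B) = fvF A ++ fvF B
  fvF (neg A)   = fvF A

closedT : Term → Bool
closedT t = null (fvT t)

Closed : Term → Set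
Closed t = fvT t ≡ []

mutual
  maxVarT : Term → ℕ
  maxVarT (var y)   = y
  maxVarT zer       = 0
  maxVarT (sc a)    = maxVarT a
  maxVarT (dd a)    = maxVarT a
  maxVarT (pl a b)  = maxVarT a ⊔ maxVarT b
  maxVarT (tm a b)  = maxVarT a ⊔ maxVarT b
  maxVarT (eps y A) = y ⊔ maxVarF A

  maxVarF : Formula → ℕ
  maxVarF (eqn a b) = maxVarT a ⊔ maxVarT b
  maxVarF (imp A B) = maxVarF A ⊔ maxVarF B
  maxVarF (neg A)   = maxVarF A

mutual
  data OccT (s : Term) : Term → Set where
    here : OccT s s
    inSc  : ∀ {a}   → OccT s a → OccT s (sc a)
    inDd  : ∀ {a}   → OccT s a → OccT s (dd a)
    inPlL : ∀ {a b} → OccT s a → OccT s (pl a b)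
    inPlR : ∀ {a b} → OccT s b → OccT s (pl a b)
    inTmL : ∀ {a b} → OccT s a → OccT s (tm a b)
    inTmR : ∀ {a b} → OccT s b → OccT s (tm a b)
    inEps : ∀ {y A} → OccF s A → OccT s (eps y A)

  data OccF (s : Term) : Formula → Set where
    inEqL  : ∀ {a b} → OccT s a → OccF s (eqn a b)
    inEqR  : ∀ {a b} → OccT s b → OccF s (eqn a b)
    inImpL : ∀ {A B} → OccF s A → OccF s (imp A B)
    inImpR : ∀ {A B} → OccF s B → OccF s (imp A B)
    inNeg  : ∀ {A}   → OccF s A → OccF s (neg A)

ClosedEps : Term → Set
ClosedEps t = (∃[ x ] ∃[ A ] t ≡ eps x A) × Closed t

EpsTermOf : List Formula → Term → Set
EpsTermOf Φ t = ClosedEps t × (∃[ φ ] (φ ∈ Φ × OccF t φ))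

-- In a closed term ε_x A every maximal closed proper
-- subterm occurrence (these are the immediate subterms in which x does
-- not occur free) is replaced, from left to right, by the fresh
-- variables m, m+1, m+2, ... where m = 1 + (largest variable name
-- occurring in ε_x A).  abstractT n t returns the resulting term and
-- the list of replaced subterms, the first fresh variable being n.

mutual
  abstractT : ℕ → Term → Term × List Term
  abstractT n t = if closedT t then (var n , [ t ]) else abstractT′ n t

  abstractT′ : ℕ → Term → Term × List Term
  abstractT′ n (var y)   = var y , []
  abstractT′ n zer       = zer , []
  abstractT′ n (sc a)    = sc (proj₁ (abstractT n a)) , proj₂ (abstractT n a)
  abstractT′ n (dd a)    = dd (proj₁ (abstractT n a)) , proj₂ (abstractT n a)
  abstractT′ n (pl a b)  =
    let ra = abstractT n a ; rb = abstractT (n + length (proj₂ ra)) b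
    in pl (proj₁ ra) (proj₁ rb) , proj₂ ra ++ proj₂ rb
  abstractT′ n (tm a b)  =
    let ra = abstractT n a ; rb = abstractT (n + length (proj₂ ra)) b
    in tm (proj₁ ra) (proj₁ rb) , proj₂ ra ++ proj₂ rb
  abstractT′ n (eps y A) = eps y (proj₁ (abstractF n A)) , proj₂ (abstractF n A)

  abstractF : ℕ → Formula → Formula × List Term
  abstractF n (eqn a b) =
    let ra = abstractT n a ; rb = abstractT (n + length (proj₂ ra)) b
    in eqn (proj₁ ra) (proj₁ rb) , proj₂ ra ++ proj₂ rb
  abstractF n (imp A B) =
    let rA = abstractF n A ; rB = abstractF (n + length (proj₂ rA)) B
    in imp (proj₁ rA) (proj₁ rB) , proj₂ rA ++ proj₂ rB
  abstractF n (neg A)   = neg (proj₁ (abstractF n A)) , proj₂ (abstractF n A)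

-- category of an ε-term (for other terms the value is irrelevant)
category : Term → Term
category (eps x A) = eps x (proj₁ (abstractF (suc (maxVarT (eps x A))) A))
category t         = t

immSubterms : Term → List Term
immSubterms (eps x A) = proj₂ (abstractF (suc (maxVarT (eps x A))) A)
immSubterms t         = []

arity : Term → ℕ
arity t = length (immSubterms t)

-- a substitution assigns to each category c a function; it is applied
-- to argument lists of length (arity of c).
Substitution : Set
Substitution = Term → List ℕ → ℕ

-- value of a (closed) term under S, and the values of the replaced
-- immediate subterms (computed in the same left-to-right order as
-- abstractT / abstractF).
mutual
  valT : Substitution → Term → ℕ
  valT S (var y)   = 0
  valT S zer       = 0
  valT S (sc a)    = suc (valT S a)
  valT S (dd a)    = pred (valT S a)
  valT S (pl a b)  = valT S a + valT S b
  valT S (tm a b)  = valT S a * valT S b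
  valT S (eps x A) = S (category (eps x A)) (argValsF S A)

  argValsT : Substitution → Term → List ℕ
  argValsT S t = if closedT t then [ valT S t ] else argValsT′ S t

  argValsT′ : Substitution → Term → List ℕ
  argValsT′ S (var y)   = []
  argValsT′ S zer       = []
  argValsT′ S (sc a)    = argValsT S a
  argValsT′ S (dd a)    = argValsT S a
  argValsT′ S (pl a b)  = argValsT S a ++ argValsT S b
  argValsT′ S (tm a b)  = argValsT S a ++ argValsT S b
  argValsT′ S (eps y A) = argValsF S A

  argValsF : Substitution → Formula → List ℕ
  argValsF S (eqn a b) = argValsT S a ++ argValsT S b
  argValsF S (imp A B) = argValsF S A ++ argValsF S B
  argValsF S (neg A)   = argValsF S A

Progressive : List Formula → Substitution → Substitution → Set
Progressive Φ S T =
  ∀ e → EpsTermOf Φ e → ∀ (args : List ℕ) → length args ≡ arity e →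
  ¬ (S (category e) args ≡ 0) → T (category e) args ≡ S (category e) args

IsEnumeration : List Formula → List Term → Set
IsEnumeration Φ as =
  Unique as ×
  (∀ t → (t ∈ as) ⇔ EpsTermOf Φ t) ×
  (∀ (i j : Fin (length as)) → OccT (lookup as i) (lookup as j) → toℕ i ≤ toℕ j)

isZero : ℕ → ℕ
isZero zero    = 1
isZero (suc _) = 0

order : Substitution → List Term → ℕ
order S []       = 0
order S (a ∷ as) = 2 ^ length as * isZero (valT S a) + order S as

-- Enumerate the closed ε-terms a₀, …, a_k of Φ with subterms first and read
-- o(S) as the binary number whose i-th digit is 1 iff S gives aᵢ the value 0.
-- Let aᵢ = ε_x A be the first term on which S and T disagree.  Every closed
-- ε-term occurring in A is some earlier aⱼ, so S and T compute the same
-- arguments for the category of aᵢ.  Were the S-value of aᵢ nonzero,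
-- progressiveness would make the T-value equal to it; hence S gives aᵢ the
-- value 0 and T does not: T loses the digit i while agreeing on all higher
-- digits, so o(T) < o(S).
module Submission where

open import Defs
open import Data.List using (List; []; _∷_; _++_; length; lookup; null; [_])
open import Data.List.Properties using (length-++; ++-conicalˡ; ++-conicalʳ)
open import Data.List.Membership.Propositional using (_∈_)
open import Data.List.Membership.Propositional.Properties using (∈-++⁺ʳ)
open import Data.List.Relation.Unary.All as All using (All; []; _∷_)
open import Data.List.Relation.Unary.Any using (here; there; index)
open import Data.List.Relation.Unary.Any.Properties using (lookup-index)
open import Data.Nat using (ℕ; zero; suc; _+_; _*_; _^_; _≤_; _<_; pred; z≤n; s≤s; s≤s⁻¹)
open import Data.Nat.Properties
open import Data.Fin as Fin using (Fin; toℕ)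
open import Data.Bool using (true; false)
open import Data.Product using (_,_; proj₂)
open import Data.Sum using (_⊎_; inj₁; inj₂)
open import Function using (_∘_)
open import Function.Bundles using (Equivalence)
open import Relation.Nullary using (¬_; yes; no; contradiction)
open import Relation.Binary.PropositionalEquality
  using (_≡_; _≢_; refl; sym; trans; cong; cong₂; subst; module ≡-Reasoning)

mutual
  occT-trans : ∀ {s t u} → OccT s t → OccT t u → OccT s u
  occT-trans p here      = p
  occT-trans p (inSc q)  = inSc (occT-trans p q)
  occT-trans p (inDd q)  = inDd (occT-trans p q)
  occT-trans p (inPlL q) = inPlL (occT-trans p q)
  occT-trans p (inPlR q) = inPlR (occT-trans p q)
  occT-trans p (inTmL q) = inTmL (occT-trans p q)
  occT-trans p (inTmR q) = inTmR (occT-trans p q)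
  occT-trans p (inEps q) = inEps (occT-occF-trans p q)

  occT-occF-trans : ∀ {s t A} → OccT s t → OccF t A → OccF s A
  occT-occF-trans p (inEqL q)  = inEqL (occT-trans p q)
  occT-occF-trans p (inEqR q)  = inEqR (occT-trans p q)
  occT-occF-trans p (inImpL q) = inImpL (occT-occF-trans p q)
  occT-occF-trans p (inImpR q) = inImpR (occT-occF-trans p q)
  occT-occF-trans p (inNeg q)  = inNeg (occT-occF-trans p q)

mutual
  sizeT : Term → ℕ
  sizeT (var _)   = 1
  sizeT zer       = 1
  sizeT (sc a)    = suc (sizeT a)
  sizeT (dd a)    = suc (sizeT a)
  sizeT (pl a b)  = suc (sizeT a + sizeT b)
  sizeT (tm a b)  = suc (sizeT a + sizeT b)
  sizeT (eps _ A) = suc (sizeF A)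

  sizeF : Formula → ℕ
  sizeF (eqn a b) = suc (sizeT a + sizeT b)
  sizeF (imp A B) = suc (sizeF A + sizeF B)
  sizeF (neg A)   = suc (sizeF A)

private
  ≤-left : ∀ {k} m n → k ≤ m → k ≤ suc (m + n)
  ≤-left m n k≤m = m≤n⇒m≤1+n (≤-trans k≤m (m≤m+n m n))

  ≤-right : ∀ {k} m n → k ≤ n → k ≤ suc (m + n)
  ≤-right m n k≤n = m≤n⇒m≤1+n (≤-trans k≤n (m≤n+m n m))

mutual
  occT⇒sizeT≤ : ∀ {s t} → OccT s t → sizeT s ≤ sizeT t
  occT⇒sizeT≤ here                = ≤-refl
  occT⇒sizeT≤ (inSc q)            = m≤n⇒m≤1+n (occT⇒sizeT≤ q)
  occT⇒sizeT≤ (inDd q)            = m≤n⇒m≤1+n (occT⇒sizeT≤ q)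
  occT⇒sizeT≤ {t = pl a b} (inPlL q) = ≤-left (sizeT a) (sizeT b) (occT⇒sizeT≤ q)
  occT⇒sizeT≤ {t = pl a b} (inPlR q) = ≤-right (sizeT a) (sizeT b) (occT⇒sizeT≤ q)
  occT⇒sizeT≤ {t = tm a b} (inTmL q) = ≤-left (sizeT a) (sizeT b) (occT⇒sizeT≤ q)
  occT⇒sizeT≤ {t = tm a b} (inTmR q) = ≤-right (sizeT a) (sizeT b) (occT⇒sizeT≤ q)
  occT⇒sizeT≤ (inEps q)           = m≤n⇒m≤1+n (occF⇒sizeT≤ q)

  occF⇒sizeT≤ : ∀ {s A} → OccF s A → sizeT s ≤ sizeF A
  occF⇒sizeT≤ {A = eqn a b} (inEqL q)  = ≤-left (sizeT a) (sizeT b) (occT⇒sizeT≤ q)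
  occF⇒sizeT≤ {A = eqn a b} (inEqR q)  = ≤-right (sizeT a) (sizeT b) (occT⇒sizeT≤ q)
  occF⇒sizeT≤ {A = imp A B} (inImpL q) = ≤-left (sizeF A) (sizeF B) (occF⇒sizeT≤ q)
  occF⇒sizeT≤ {A = imp A B} (inImpR q) = ≤-right (sizeF A) (sizeF B) (occF⇒sizeT≤ q)
  occF⇒sizeT≤ (inNeg q)                = m≤n⇒m≤1+n (occF⇒sizeT≤ q)

¬occF-eps-body : ∀ {x A} → ¬ OccF (eps x A) A
¬occF-eps-body q = 1+n≰n (occF⇒sizeT≤ q)

null⇒≡[] : ∀ {A : Set} (xs : List A) → null xs ≡ true → xs ≡ []
null⇒≡[] []      _  = refl
null⇒≡[] (_ ∷ _) ()

length-++-cong : ∀ {A B : Set} (xs : List A) {ys : List A} (us : List B) {vs : List B} →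
                 length xs ≡ length us → length ys ≡ length vs →
                 length (xs ++ ys) ≡ length (us ++ vs)
length-++-cong xs us p q =
  trans (length-++ xs) (trans (cong₂ _+_ p q) (sym (length-++ us)))

module _ (S : Substitution) where

  mutual
    length-argValsT : ∀ n t → length (argValsT S t) ≡ length (proj₂ (abstractT n t))
    length-argValsT n t with closedT t
    ... | true  = refl
    ... | false = length-argValsT′ n t

    length-argValsT′ : ∀ n t → length (argValsT′ S t) ≡ length (proj₂ (abstractT′ n t))
    length-argValsT′ n (var y)   = refl
    length-argValsT′ n zer       = refl
    length-argValsT′ n (sc a)    = length-argValsT n a
    length-argValsT′ n (dd a)    = length-argValsT n a
    length-argValsT′ n (pl a b)  = length-++-cong (argValsT S a) (proj₂ (abstractT n a))
                                     (length-argValsT n a) (length-argValsT _ b)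
    length-argValsT′ n (tm a b)  = length-++-cong (argValsT S a) (proj₂ (abstractT n a))
                                     (length-argValsT n a) (length-argValsT _ b)
    length-argValsT′ n (eps y A) = length-argValsF n A

    length-argValsF : ∀ n A → length (argValsF S A) ≡ length (proj₂ (abstractF n A))
    length-argValsF n (eqn a b) = length-++-cong (argValsT S a) (proj₂ (abstractT n a))
                                    (length-argValsT n a) (length-argValsT _ b)
    length-argValsF n (imp A B) = length-++-cong (argValsF S A) (proj₂ (abstractF n A))
                                    (length-argValsF n A) (length-argValsF _ B)
    length-argValsF n (neg A)   = length-argValsF n A

module _ (S T : Substitution) where

  Agree : Term → Set
  Agree t = valT S t ≡ valT T t

  AgreeBelowT : Term → Set
  AgreeBelowT t = ∀ {e} → OccT e t → ClosedEps e → Agree e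

  AgreeBelowF : Formula → Set
  AgreeBelowF A = ∀ {e} → OccF e A → ClosedEps e → Agree e

  valT-cong : ∀ t → Closed t → AgreeBelowT t → Agree t
  valT-cong (var y)   ()
  valT-cong zer       c h = refl
  valT-cong (sc a)    c h = cong suc (valT-cong a c (h ∘ inSc))
  valT-cong (dd a)    c h = cong pred (valT-cong a c (h ∘ inDd))
  valT-cong (pl a b)  c h = cong₂ _+_
    (valT-cong a (++-conicalˡ (fvT a) _ c) (h ∘ inPlL))
    (valT-cong b (++-conicalʳ (fvT a) _ c) (h ∘ inPlR))
  valT-cong (tm a b)  c h = cong₂ _*_
    (valT-cong a (++-conicalˡ (fvT a) _ c) (h ∘ inTmL))
    (valT-cong b (++-conicalʳ (fvT a) _ c) (h ∘ inTmR))
  valT-cong (eps y A) c h = h here ((y , A , refl) , c)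

  mutual
    argValsT-cong : ∀ t → AgreeBelowT t → argValsT S t ≡ argValsT T t
    argValsT-cong t h with closedT t in closed
    ... | true  = cong [_] (valT-cong t (null⇒≡[] (fvT t) closed) h)
    ... | false = argValsT′-cong t h

    argValsT′-cong : ∀ t → AgreeBelowT t → argValsT′ S t ≡ argValsT′ T t
    argValsT′-cong (var y)   h = refl
    argValsT′-cong zer       h = refl
    argValsT′-cong (sc a)    h = argValsT-cong a (h ∘ inSc)
    argValsT′-cong (dd a)    h = argValsT-cong a (h ∘ inDd)
    argValsT′-cong (pl a b)  h = cong₂ _++_ (argValsT-cong a (h ∘ inPlL)) (argValsT-cong b (h ∘ inPlR))
    argValsT′-cong (tm a b)  h = cong₂ _++_ (argValsT-cong a (h ∘ inTmL)) (argValsT-cong b (h ∘ inTmR))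
    argValsT′-cong (eps y A) h = argValsF-cong A (h ∘ inEps)

    argValsF-cong : ∀ A → AgreeBelowF A → argValsF S A ≡ argValsF T A
    argValsF-cong (eqn a b) h = cong₂ _++_ (argValsT-cong a (h ∘ inEqL)) (argValsT-cong b (h ∘ inEqR))
    argValsF-cong (imp A B) h = cong₂ _++_ (argValsF-cong A (h ∘ inImpL)) (argValsF-cong B (h ∘ inImpR))
    argValsF-cong (neg A)   h = argValsF-cong A (h ∘ inNeg)

module _ {A : Set} (R : A → A → Set) where

  OrderedBy : List A → Set
  OrderedBy xs = ∀ (i j : Fin (length xs)) → R (lookup xs i) (lookup xs j) → toℕ i ≤ toℕ j

  OrderedBy-∷⁻ : ∀ {x xs} → OrderedBy (x ∷ xs) → OrderedBy xs
  OrderedBy-∷⁻ ord i j r = s≤s⁻¹ (ord (Fin.suc i) (Fin.suc j) r)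

  OrderedBy-prefix : ∀ pre {a rest e} → OrderedBy (pre ++ a ∷ rest) → R e a →
                     e ∈ pre ++ a ∷ rest → e ≢ a → e ∈ pre
  OrderedBy-prefix []        ord r (here e≡a) e≢a = contradiction e≡a e≢a
  OrderedBy-prefix [] {a}    ord r (there p)  e≢a
    with () ← ord (Fin.suc (index p)) Fin.zero (subst (λ t → R t a) (lookup-index p) r)
  OrderedBy-prefix (x ∷ pre) ord r (here e≡x) e≢a = here e≡x
  OrderedBy-prefix (x ∷ pre) ord r (there p)  e≢a =
    there (OrderedBy-prefix pre (OrderedBy-∷⁻ {x} ord) r p e≢a)

isZero≤1 : ∀ v → isZero v ≤ 1
isZero≤1 zero    = ≤-refl
isZero≤1 (suc _) = z≤n

order<2^length : ∀ S xs → order S xs < 2 ^ length xs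
order<2^length S []       = s≤s z≤n
order<2^length S (a ∷ xs) = begin-strict
    2 ^ n * isZero (valT S a) + order S xs
  <⟨ +-mono-≤-< (*-monoʳ-≤ (2 ^ n) (isZero≤1 (valT S a))) (order<2^length S xs) ⟩
    2 ^ n * 1 + 2 ^ n
  ≡⟨ cong₂ _+_ (*-identityʳ (2 ^ n)) (sym (+-identityʳ (2 ^ n))) ⟩
    2 ^ suc n ∎
  where open ≤-Reasoning
        n = length xs

module _ (S T : Substitution) where

  order-<-head : ∀ {a} xs → valT S a ≡ 0 → valT T a ≢ 0 →
                 order T (a ∷ xs) < order S (a ∷ xs)
  order-<-head {a} xs S≡0 T≢0 with valT T a
  ... | zero  = contradiction refl T≢0
  ... | suc _ rewrite S≡0 = begin-strict
      2 ^ n * 0 + order T xs  ≡⟨ cong (_+ order T xs) (*-zeroʳ (2 ^ n)) ⟩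
      order T xs              <⟨ order<2^length T xs ⟩
      2 ^ n                   ≡⟨ sym (*-identityʳ (2 ^ n)) ⟩
      2 ^ n * 1               ≤⟨ m≤m+n _ (order S xs) ⟩
      2 ^ n * 1 + order S xs  ∎
    where open ≤-Reasoning
          n = length xs

  order-<-tail : ∀ {a} xs → Agree S T a → order T xs < order S xs →
                 order T (a ∷ xs) < order S (a ∷ xs)
  order-<-tail {a} xs a-agrees lt rewrite a-agrees = +-monoʳ-< (2 ^ length xs * isZero (valT T a)) lt

  ZeroAtFirstDisagreement : List Term → Set
  ZeroAtFirstDisagreement xs = ∀ pre {a rest} → xs ≡ pre ++ a ∷ rest →
                               All (Agree S T) pre → Agree S T a ⊎ valT S a ≡ 0

  order-<-or-agree : ∀ xs → ZeroAtFirstDisagreement xs →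
                     order T xs < order S xs ⊎ All (Agree S T) xs
  order-<-or-agree []       _    = inj₂ []
  order-<-or-agree (a ∷ xs) zero-at with valT S a ≟ valT T a
  ... | no a-disagrees with zero-at [] refl []
  ...   | inj₁ a-agrees = contradiction a-agrees a-disagrees
  ...   | inj₂ S≡0      = inj₁ (order-<-head {a} xs S≡0 (λ T≡0 → a-disagrees (trans S≡0 (sym T≡0))))
  order-<-or-agree (a ∷ xs) zero-at | yes a-agrees
    with order-<-or-agree xs (λ pre eq agree → zero-at (a ∷ pre) (cong (a ∷_) eq) (a-agrees ∷ agree))
  ... | inj₁ lt     = inj₁ (order-<-tail {a} xs a-agrees lt)
  ... | inj₂ agrees = inj₂ (a-agrees ∷ agrees)

  progressive-agree-or-zero : ∀ {Φ x A} → Progressive Φ S T → EpsTermOf Φ (eps x A) →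
                              AgreeBelowF S T A → Agree S T (eps x A) ⊎ valT S (eps x A) ≡ 0
  progressive-agree-or-zero {Φ} {x} {A} prog aΦ below with valT S (eps x A) ≟ 0
  ... | yes S≡0 = inj₂ S≡0
  ... | no  S≢0 = inj₁ (sym (begin
      T (category a) (argValsF T A)  ≡⟨ cong (T (category a)) (sym (argValsF-cong S T A below)) ⟩
      T (category a) (argValsF S A)  ≡⟨ prog a aΦ (argValsF S A) (length-argValsF S _ A) S≢0 ⟩
      S (category a) (argValsF S A)  ∎))
    where open ≡-Reasoning
          a = eps x A

  enumeration-zeroAtFirstDisagreement : ∀ {Φ as} → IsEnumeration Φ as → Progressive Φ S T →
                                        ZeroAtFirstDisagreement as
  enumeration-zeroAtFirstDisagreement {Φ} (_ , members , ordered) prog pre {a} refl agree-pre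
    with Equivalence.to (members a) (∈-++⁺ʳ pre (here refl))
  ... | aΦ@(((x , A , refl) , _) , φ , φ∈Φ , a∈φ) = progressive-agree-or-zero prog aΦ below
    where
    below : AgreeBelowF S T A
    below {e} e∈A e-closed = All.lookup agree-pre e∈pre
      where
      eΦ : EpsTermOf Φ e
      eΦ = e-closed , φ , φ∈Φ , occT-occF-trans (inEps e∈A) a∈φ
      e∈pre : e ∈ pre
      e∈pre = OrderedBy-prefix OccT pre ordered (inEps e∈A)
                (Equivalence.from (members e) eΦ) (λ { refl → ¬occF-eps-body e∈A })

theorem8 : (Φ : List Formula) (S T : Substitution) (as : List Term) →
    IsEnumeration Φ as → Progressive Φ S T →
    order T as < order S as ⊎ (∀ t → EpsTermOf Φ t → valT S t ≡ valT T t)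
theorem8 Φ S T as enum@(_ , members , _) prog
  with order-<-or-agree S T as (enumeration-zeroAtFirstDisagreement S T enum prog)
... | inj₁ lt     = inj₁ lt
... | inj₂ agrees = inj₂ (λ t tΦ → All.lookup agrees (Equivalence.from (members t) tΦ))
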